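{- Let $m \ge 3$ be an odd integer and let $\Gamma = C_m \square C_{2m}$. Let $a_0,\ldots,a_{m-1} \in \{1-2m^2,\ldots,2m^2-1\}$ be odd integers and $b_0,\ldots,b_{m-1}\in\{ -2m^2,\ldots,2m^2-2\}$ be even integers such that $a_0=1$, $b_0=0$ and $\{x(a_i+b_j) : x\in\{ -1,1\},\ 0\le i,j<m\} = \mathcal{N}_{2m^2}$. Then the table $\mathcal{T}([a_0,\ldots,a_{m-1}],\frac{m-1}{2}) + \mathcal{T}([b_0,\ldots,b_{m-1}],\frac{m+1}{2})$ is distance magic. Consequently, $\Gamma$ is distance magic.
   Context: $\mathcal{N}_N=\{1-N,3-N,\ldots,N-1\}$. A graph of order $N$ is distance magic if it admits a bijective labeling of its vertices by $\{1,\dots,N\}$ with all neighbour sums equal (equivalently, for regular graphs, a bijection to $\mathcal{N}_N$ with all neighbour sums $0$). $C_m\square C_{2m}$ is the Cayley graph of $\mathbb{Z}_m\times\mathbb{Z}_{2m}$ with connection set $\{\pm(1,0),\pm(0,1)\}$. For a sequence $R=[r_0,\ldots,r_{m-1}]$ of integers and $s\in\{0,\ldots,m-1\}$, $\mathcal{T}(R,s)$ is the $m\times m$ table $[t_{i,j}]_{0\le i,j<m}$ with $t_{i,j}=r_{j-si}$ (index modulo $m$). The sum of two $m\times m$ tables is entrywise. An $m\times m$ table $T=[t_{i,j}]$ ($m$ odd, indices modulo $m$) is distance magic if (i) for every $k\in\mathcal{N}_{2m^2}$ exactly one of $k,-k$ appears in $T$, and (ii) $t_{i-1,j}+t_{i+1,j}=t_{i,j+\frac{m-1}{2}}+t_{i,j-\frac{m-1}{2}}$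 for all $0\le i,j<m$. -}

module Defs where

open import Data.Nat as ℕ using (ℕ; zero; suc; _<_)
open import Data.Nat.DivMod as NDM using ()
open import Data.Fin as Fin using (Fin; toℕ)
open import Data.Integer as ℤ using (ℤ; +_; -_; _+_; _-_; _*_)
open import Data.Integer.DivMod using (_%ℕ_)
open import Data.Product using (Σ; ∃; _×_; _,_)
open import Data.Sum using (_⊎_)
open import Data.List using (List; []; _∷_; map)
open import Data.Nat.ListAction using (sum)
open import Function.Bundles using (_⤖_; Bijection)
open import Relation.Binary.PropositionalEquality using (_≡_)
open import Relation.Nullary using (¬_)

shift : ∀ {n} → Fin n → ℤ → Fin n
shift {suc k} x d = NDM._mod_ (((+ toℕ x) + d) %ℕ suc k) (suc k)

Table : ℕ → Set
Table m = Fin m → Fin m → ℤ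

-- 𝒯(R,s): t_{i,j} = r_{j - s i} (index modulo m); R is a sequence, only r_0..r_{m-1} used
𝒯 : ∀ {m} → (ℕ → ℤ) → ℕ → Table m
𝒯 R s i j = R (toℕ (shift j (- ((+ s) * (+ toℕ i)))))

_⊞_ : ∀ {m} → Table m → Table m → Table m
(T ⊞ U) i j = T i j + U i j

In𝒩 : ℕ → ℤ → Set
In𝒩 N k = Σ ℕ λ t → t < N × k ≡ (+ 1) - (+ N) + (+ 2) * (+ t)

Appears : ∀ {m} → Table m → ℤ → Set
Appears T k = Σ _ λ i → Σ _ λ j → T i j ≡ k

DistanceMagicTable : (m : ℕ) → Table m → Set
DistanceMagicTable m T =
  (∀ k → In𝒩 (2 ℕ.* (m ℕ.* m)) k →
     (Appears T k × ¬ Appears T (- k)) ⊎ (¬ Appears T k × Appears T (- k)))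
  × (∀ i j → T (shift i (- + 1)) j + T (shift i (+ 1)) j
              ≡ T i (shift j (+ h)) + T i (shift j (- (+ h))))
  where h = (m ℕ.∸ 1) NDM./ 2

DistanceMagicGraph : (N : ℕ) (V : Set) → (V → List V) → Set
DistanceMagicGraph N V nbrs =
  Σ (V ⤖ Fin N) λ ℓ → Σ ℕ λ c → ∀ v →
    sum (map (λ u → suc (toℕ (Bijection.to ℓ u))) (nbrs v)) ≡ c

-- C_m □ C_{2m}: Cayley graph of ℤ_m × ℤ_{2m} with connection set {±(1,0), ±(0,1)}
CVertex : ℕ → Set
CVertex m = Fin m × Fin (2 ℕ.* m)

CNbrs : (m : ℕ) → CVertex m → List (CVertex m)
CNbrs m (x , y) =
  (shift x (+ 1) , y) ∷ (shift x (- + 1) , y) ∷ (x , shift y (+ 1)) ∷ (x , shift y (- + 1)) ∷ []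

CmCm2DistanceMagic : ℕ → Set
CmCm2DistanceMagic m = DistanceMagicGraph (2 ℕ.* (m ℕ.* m)) (CVertex m) (CNbrs m)

{-# OPTIONS --safe #-}
-- Write m = 2s + 1, so T = 𝒯(a, s) + 𝒯(b, s + 1) has entries t_{i,j} = a_{j−si} + b_{j−(s+1)i}.
-- Since (i, j) ↦ (j − si, j − (s+1)i) is a bijection of ℤ_m², every sum a_p + b_q is an entry of T.
-- The 2m² signed sums ±(a_p + b_q) cover the 2m²-element set 𝒩_{2m²}, so they are pairwise
-- distinct and no −(a_p + b_q) is an entry: this is (i). For (ii), moving one row in 𝒯(R, s) is
-- moving s columns, and the slopes s and s + 1 ≡ −s (mod m) move in opposite directions.
-- For the graph, label (x, y) ∈ ℤ_m × ℤ_2m by (−1)^y t_{x,sy}: by (ii) the four neighbour labels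
-- cancel, and as y ↦ (y mod 2, sy mod m) is onto ℤ_2 × ℤ_m the labels run through 𝒩_{2m²} exactly
-- once. Shifting k ↦ (k + 2m² + 1)/2 gives labels 1, …, 2m² with constant neighbour sums.
module Submission where

open import Defs
open import Data.Nat as ℕ using (ℕ; _<_; _≤_)
open import Data.Nat.DivMod as NDM using ()
open import Data.Nat.Divisibility as ND using ()
open import Data.Integer as ℤ using (ℤ; +_; -_; _+_; _-_; _*_)
open import Data.Integer.Divisibility as ZD using ()
open import Data.Product using (Σ; _×_)
open import Data.Sum using (_⊎_)
open import Function.Bundles using (_⇔_)
open import Relation.Binary.PropositionalEquality using (_≡_)
open import Relation.Nullary using (¬_)

open import Data.Nat using (zero; suc)
import Data.Nat.Properties as ℕP
open import Data.Nat.Tactic.RingSolver as ℕSolver using ()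
open import Data.Nat.ListAction using (sum)
open import Data.Integer using (0ℤ; +[1+_]; -[1+_])
import Data.Integer.Properties as ℤP
open import Data.Integer.DivMod using (_%ℕ_; _/ℕ_; n%ℕd<d; a≡a%ℕn+[a/ℕn]*n)
open import Data.Integer.Tactic.RingSolver using (solve-∀)
open import Data.Fin as Fin using (Fin; toℕ; fromℕ<; punchOut)
import Data.Fin.Properties as FinP
open import Data.List using (List; []; _∷_; map; foldr; length)
open import Data.List.Properties using (map-cong)
open import Data.Product using (∃; _,_; proj₁; proj₂)
open import Data.Product.Function.NonDependent.Propositional using (_×-↔_)
open import Data.Sum using (inj₁; inj₂)
open import Function using (_∘_)
open import Function.Bundles using (Equivalence; mk⇔; _↔_; Inverse; _⤖_; mk⤖; Bijection)
open import Function.Definitions using (Injective; StrictlySurjective)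
open import Function.Consequences.Propositional using (strictlySurjective⇒surjective)
open import Function.Properties.Inverse using (↔-refl; ↔-sym; ↔-trans)
open import Algebra.Properties.CommutativeSemigroup ℤP.+-commutativeSemigroup using (interchange)
open import Relation.Binary.Bundles using (Setoid)
import Relation.Binary.Reasoning.Setoid as SetoidReasoning
open import Relation.Binary.PropositionalEquality
  using (refl; sym; trans; cong; cong₂; subst; subst₂; _≢_; module ≡-Reasoning)
open import Relation.Nullary using (yes; no; contradiction)
open import Data.Empty using (⊥-elim)

infix 4 _≡_mod_

record _≡_mod_ (x y : ℤ) (n : ℕ) : Set where
  constructor mk≡mod
  field
    quotient : ℤ
    equation : x ≡ y + quotient * + n

module _ {n : ℕ} where

  ≡⇒≡mod : ∀ {x y} → x ≡ y → x ≡ y mod n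
  ≡⇒≡mod {x} refl = mk≡mod 0ℤ (sym (ℤP.+-identityʳ x))

  ≡mod-refl : ∀ {x} → x ≡ x mod n
  ≡mod-refl = ≡⇒≡mod refl

  ≡mod-sym : ∀ {x y} → x ≡ y mod n → y ≡ x mod n
  ≡mod-sym {y = y} (mk≡mod k x≡y+kn) =
    mk≡mod (- k) (trans (y≡y+kn-kn y k (+ n)) (cong (λ x → x + - k * + n) (sym x≡y+kn)))
    where
    y≡y+kn-kn : ∀ y k n → y ≡ (y + k * n) + - k * n
    y≡y+kn-kn = solve-∀

  ≡mod-trans : ∀ {x y z} → x ≡ y mod n → y ≡ z mod n → x ≡ z mod n
  ≡mod-trans {z = z} (mk≡mod k refl) (mk≡mod l refl) = mk≡mod (l + k) (collect z l k (+ n))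
    where
    collect : ∀ z l k n → (z + l * n) + k * n ≡ z + (l + k) * n
    collect = solve-∀

  ≡mod-+ : ∀ {x x' y y'} → x ≡ x' mod n → y ≡ y' mod n → x + y ≡ x' + y' mod n
  ≡mod-+ {x' = x'} {y' = y'} (mk≡mod k refl) (mk≡mod l refl) = mk≡mod (k + l) (collect x' y' k l (+ n))
    where
    collect : ∀ x y k l n → (x + k * n) + (y + l * n) ≡ (x + y) + (k + l) * n
    collect = solve-∀

  ≡mod-*ˡ : ∀ c {x y} → x ≡ y mod n → c * x ≡ c * y mod n
  ≡mod-*ˡ c {y = y} (mk≡mod k refl) = mk≡mod (c * k) (distribute c y k (+ n))
    where
    distribute : ∀ c y k n → c * (y + k * n) ≡ c * y + (c * k) * n
    distribute = solve-∀

  ≡mod-neg : ∀ {x y} → x ≡ y mod n → - x ≡ - y mod n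
  ≡mod-neg {y = y} (mk≡mod k refl) = mk≡mod (- k) (negate y k (+ n))
    where
    negate : ∀ y k n → - (y + k * n) ≡ - y + (- k) * n
    negate = solve-∀

≡mod-setoid : ℕ → Setoid _ _
≡mod-setoid n = record
  { Carrier = ℤ
  ; _≈_ = λ x y → x ≡ y mod n
  ; isEquivalence = record { refl = ≡mod-refl ; sym = ≡mod-sym ; trans = ≡mod-trans }
  }

module ≡mod-Reasoning (n : ℕ) = SetoidReasoning (≡mod-setoid n)

≡mod-∣ : ∀ {d n x y} → d ND.∣ n → x ≡ y mod n → x ≡ y mod d
≡mod-∣ {d} {y = y} (ND.divides q refl) (mk≡mod k refl) =
  mk≡mod (k * + q) (cong (λ u → y + u) (trans (cong (k *_) (ℤP.pos-* q d)) (sym (ℤP.*-assoc k (+ q) (+ d)))))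

%ℕ-≡mod : ∀ z n .{{_ : ℕ.NonZero n}} → + (z %ℕ n) ≡ z mod n
%ℕ-≡mod z n = ≡mod-sym (mk≡mod (z /ℕ n) (a≡a%ℕn+[a/ℕn]*n z n))

private
  no-wrap : ∀ {n r} r' k → r < n → + r ≢ + r' + +[1+ k ] * + n
  no-wrap {n} {r} r' k r<n r≡r'+[1+k]n = ℕP.<⇒≱ r<n (begin
    n                     ≤⟨ ℕP.m≤m+n n (k ℕ.* n) ⟩
    suc k ℕ.* n           ≤⟨ ℕP.m≤n+m (suc k ℕ.* n) r' ⟩
    r' ℕ.+ suc k ℕ.* n    ≡⟨ ℤP.+-injective (trans r≡r'+[1+k]n (cong (λ u → + r' + u) (sym (ℤP.pos-* (suc k) n)))) ⟨
    r                     ∎)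
    where open ℕP.≤-Reasoning

≡mod-<⇒≡ : ∀ {n r r'} → r < n → r' < n → + r ≡ + r' mod n → r ≡ r'
≡mod-<⇒≡ _   _    (mk≡mod (+ zero) eq)   = ℤP.+-injective (trans eq (ℤP.+-identityʳ _))
≡mod-<⇒≡ r<n _    (mk≡mod +[1+ k ] eq)   = contradiction eq (no-wrap _ k r<n)
≡mod-<⇒≡ _   r'<n c@(mk≡mod -[1+ k ] _) = contradiction (_≡_mod_.equation (≡mod-sym c)) (no-wrap _ k r'<n)

toℕ-≡mod-injective : ∀ {n} {x y : Fin n} → + toℕ x ≡ + toℕ y mod n → x ≡ y
toℕ-≡mod-injective x≡y = FinP.toℕ-injective (≡mod-<⇒≡ (FinP.toℕ<n _) (FinP.toℕ<n _) x≡y)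

toℕ-shift : ∀ {n} (x : Fin (suc n)) d → + toℕ (shift x d) ≡ + toℕ x + d mod suc n
toℕ-shift {n} x d = ≡mod-trans (≡⇒≡mod (cong +_ toℕ-shift≡%ℕ)) (%ℕ-≡mod (+ toℕ x + d) (suc n))
  where
  toℕ-shift≡%ℕ : toℕ (shift x d) ≡ (+ toℕ x + d) %ℕ suc n
  toℕ-shift≡%ℕ = trans (FinP.toℕ-fromℕ< _) (NDM.m<n⇒m%n≡m (n%ℕd<d (+ toℕ x + d) (suc n)))

reduce : ∀ {n} → ℤ → Fin (suc n)
reduce = shift Fin.zero

toℕ-reduce : ∀ {n} z → + toℕ (reduce {n} z) ≡ z mod suc n
toℕ-reduce z = ≡mod-trans (toℕ-shift Fin.zero z) (≡⇒≡mod (ℤP.+-identityˡ z))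

module _ {k : ℕ} where

  -- 𝒯 R s i j is definitionally R (toℕ (diagonal s i j)).
  diagonal : ℕ → Fin (suc k) → Fin (suc k) → Fin (suc k)
  diagonal s i j = shift j (- (+ s * + toℕ i))

  diagonal-cong : ∀ s {i j I J} → + toℕ i ≡ I mod suc k → + toℕ j ≡ J mod suc k →
                  + toℕ (diagonal s i j) ≡ J - + s * I mod suc k
  diagonal-cong s {i} {j} i≡I j≡J =
    ≡mod-trans (toℕ-shift j (- (+ s * + toℕ i))) (≡mod-+ j≡J (≡mod-neg (≡mod-*ˡ (+ s) i≡I)))

  𝒯-row-shift≡column-shift : ∀ (R : ℕ → ℤ) s i j d c → c ≡ - (+ s * d) mod suc k →
                𝒯 R s (shift i d) j ≡ 𝒯 R s i (shift j c)
  𝒯-row-shift≡column-shift R s i j d c c≡-sd = cong (R ∘ toℕ) (toℕ-≡mod-injective (begin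
    + toℕ (diagonal s (shift i d) j)     ≈⟨ diagonal-cong s (toℕ-shift i d) ≡mod-refl ⟩
    J - S * (I + d)                      ≡⟨ regroup J S I d ⟩
    (J + - (S * d)) - S * I              ≈⟨ ≡mod-+ (≡mod-+ (≡mod-refl {x = J}) (≡mod-sym c≡-sd)) ≡mod-refl ⟩
    (J + c) - S * I                      ≈⟨ diagonal-cong s ≡mod-refl (toℕ-shift j c) ⟨
    + toℕ (diagonal s i (shift j c))     ∎))
    where
    open ≡mod-Reasoning (suc k)
    S I J : ℤ
    S = + s
    I = + toℕ i
    J = + toℕ j
    regroup : ∀ J S I d → J - S * (I + d) ≡ (J + - (S * d)) - S * I
    regroup = solve-∀

  diagonals-surjective : ∀ s (i j : Fin (suc k)) →
    ∃ λ ((p , q) : Fin (suc k) × Fin (suc k)) → diagonal s p q ≡ i × diagonal (suc s) p q ≡ j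
  diagonals-surjective s i j = (p , q) , toℕ-≡mod-injective diagonal≡i , toℕ-≡mod-injective diagonal≡j
    where
    open ≡mod-Reasoning (suc k)
    S I J P Q : ℤ
    S = + s
    I = + toℕ i
    J = + toℕ j
    P = I - J
    Q = I + S * P
    p q : Fin (suc k)
    p = reduce P
    q = reduce Q
    diagonal≡i : + toℕ (diagonal s p q) ≡ I mod suc k
    diagonal≡i = begin
      + toℕ (diagonal s p q)   ≈⟨ diagonal-cong s (toℕ-reduce P) (toℕ-reduce Q) ⟩
      Q - S * P                ≡⟨ cancel I J S ⟩
      I                        ∎
      where
      cancel : ∀ I J S → (I + S * (I - J)) - S * (I - J) ≡ I
      cancel = solve-∀
    diagonal≡j : + toℕ (diagonal (suc s) p q) ≡ J mod suc k
    diagonal≡j = begin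
      + toℕ (diagonal (suc s) p q)   ≈⟨ diagonal-cong (suc s) (toℕ-reduce P) (toℕ-reduce Q) ⟩
      Q - (+ 1 + S) * P              ≡⟨ cancel I J S ⟩
      J                              ∎
      where
      cancel : ∀ I J S → (I + S * (I - J)) - (+ 1 + S) * (I - J) ≡ J
      cancel = solve-∀

label : ∀ {N} → Fin N → ℤ
label {N} t = + 1 - + N + + 2 * + toℕ t

label+[1+N]≡2[1+t] : ∀ {N} (t : Fin N) → label t + + suc N ≡ + (2 ℕ.* suc (toℕ t))
label+[1+N]≡2[1+t] {N} t = trans ([1-N+2t]+[1+N]≡2[1+t] (+ N) (+ toℕ t)) (sym (ℤP.pos-* 2 (suc (toℕ t))))
  where
  [1-N+2t]+[1+N]≡2[1+t] : ∀ N t → (+ 1 - N + + 2 * t) + (+ 1 + N) ≡ + 2 * (+ 1 + t)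
  [1-N+2t]+[1+N]≡2[1+t] = solve-∀

label-injective : ∀ {N} → Injective _≡_ _≡_ (label {N})
label-injective {N} {t} {t'} label-t≡label-t' =
  FinP.toℕ-injective (ℕP.suc-injective (ℕP.*-cancelˡ-≡ _ _ 2 (ℤP.+-injective (begin
    + (2 ℕ.* suc (toℕ t))    ≡⟨ label+[1+N]≡2[1+t] t ⟨
    label t + + suc N        ≡⟨ cong (λ l → l + + suc N) label-t≡label-t' ⟩
    label t' + + suc N       ≡⟨ label+[1+N]≡2[1+t] t' ⟩
    + (2 ℕ.* suc (toℕ t'))   ∎))))
  where open ≡-Reasoning

In𝒩⇔label : ∀ {N k} → In𝒩 N k ⇔ ∃ λ (t : Fin N) → label t ≡ k
In𝒩⇔label {N} = mk⇔ to from
  where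
  to : ∀ {k} → In𝒩 N k → ∃ λ (t : Fin N) → label t ≡ k
  to (t , t<N , k≡label) =
    fromℕ< t<N , trans (cong (λ u → + 1 - + N + + 2 * + u) (FinP.toℕ-fromℕ< t<N)) (sym k≡label)
  from : ∀ {k} → (∃ λ (t : Fin N) → label t ≡ k) → In𝒩 N k
  from (t , refl) = toℕ t , FinP.toℕ<n t , refl

Fin-injective⇒strictlySurjective : ∀ {n} {f : Fin n → Fin n} →
  Injective _≡_ _≡_ f → StrictlySurjective _≡_ f
Fin-injective⇒strictlySurjective {suc n} {f} f-injective y with FinP.any? (λ x → f x FinP.≟ y)
... | yes y∈image = y∈image
... | no  y∉image = ⊥-elim (FinP.<⇒notInjective (ℕP.n<1+n n) punchOut-injective)
  where
  missed : ∀ x → y ≢ f x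
  missed x y≡fx = y∉image (x , sym y≡fx)
  punchOut-injective : Injective _≡_ _≡_ (λ x → punchOut (missed x))
  punchOut-injective {x} {x'} eq = f-injective (FinP.punchOut-injective (missed x) (missed x') eq)

Fin-strictlySurjective⇒injective : ∀ {n} {f : Fin n → Fin n} →
  StrictlySurjective _≡_ f → Injective _≡_ _≡_ f
Fin-strictlySurjective⇒injective {n} {f} f-surjective {x} {y} fx≡fy = begin
  x                       ≡⟨ proj₂ (section-surjective x) ⟨
  section (preimage x)    ≡⟨ cong section preimages-equal ⟩
  section (preimage y)    ≡⟨ proj₂ (section-surjective y) ⟩
  y                       ∎
  where
  open ≡-Reasoning
  section : Fin n → Fin n
  section z = proj₁ (f-surjective z)
  f∘section : ∀ z → f (section z) ≡ z
  f∘section z = proj₂ (f-surjective z)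
  section-injective : Injective _≡_ _≡_ section
  section-injective {u} {v} eq = trans (sym (f∘section u)) (trans (cong f eq) (f∘section v))
  section-surjective : StrictlySurjective _≡_ section
  section-surjective = Fin-injective⇒strictlySurjective section-injective
  preimage : Fin n → Fin n
  preimage z = proj₁ (section-surjective z)
  preimages-equal : preimage x ≡ preimage y
  preimages-equal = begin
    preimage x                ≡⟨ f∘section (preimage x) ⟨
    f (section (preimage x))  ≡⟨ cong f (proj₂ (section-surjective x)) ⟩
    f x                       ≡⟨ fx≡fy ⟩
    f y                       ≡⟨ cong f (proj₂ (section-surjective y)) ⟨
    f (section (preimage y))  ≡⟨ f∘section (preimage y) ⟩
    preimage y                ∎

↔Fin-strictlySurjective⇒injective : ∀ {A : Set} {n} → A ↔ Fin n → {f : A → Fin n} →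
  StrictlySurjective _≡_ f → Injective _≡_ _≡_ f
↔Fin-strictlySurjective⇒injective A↔Fin {f} f-surjective {x} {y} fx≡fy =
  trans (sym (from∘to x)) (trans (cong from to-x≡to-y) (from∘to y))
  where
  open Inverse A↔Fin using (to; from) renaming (strictlyInverseʳ to from∘to)
  f∘from-surjective : StrictlySurjective _≡_ (f ∘ from)
  f∘from-surjective z with f-surjective z
  ... | w , fw≡z = to w , trans (cong f (from∘to w)) fw≡z
  to-x≡to-y : to x ≡ to y
  to-x≡to-y = Fin-strictlySurjective⇒injective f∘from-surjective
    (trans (cong f (from∘to x)) (trans fx≡fy (sym (cong f (from∘to y)))))

module 𝒩-Enumeration {A : Set} {N : ℕ} (A↔Fin : A ↔ Fin N) (g : A → ℤ)
  (g-enumerates : ∀ k → In𝒩 N k ⇔ ∃ λ x → g x ≡ k) where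

  private
    labelled : ∀ x → ∃ λ (t : Fin N) → label t ≡ g x
    labelled x = Equivalence.to In𝒩⇔label (Equivalence.from (g-enumerates (g x)) (x , refl))

  index : A → Fin N
  index x = proj₁ (labelled x)

  label-index : ∀ x → label (index x) ≡ g x
  label-index x = proj₂ (labelled x)

  index-strictlySurjective : StrictlySurjective _≡_ index
  index-strictlySurjective t with Equivalence.to (g-enumerates (label t)) (Equivalence.from In𝒩⇔label (t , refl))
  ... | x , gx≡label-t = x , label-injective (trans (label-index x) gx≡label-t)

  index-injective : Injective _≡_ _≡_ index
  index-injective = ↔Fin-strictlySurjective⇒injective A↔Fin index-strictlySurjective

  index-bijection : A ⤖ Fin N
  index-bijection = mk⤖ (index-injective , strictlySurjective⇒surjective index-strictlySurjective)

  g-injective : Injective _≡_ _≡_ g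
  g-injective {x} {y} gx≡gy =
    index-injective (label-injective (trans (label-index x) (trans gx≡gy (sym (label-index y)))))

double-sum-suc≡sum-label : ∀ {N} {V : Set} (t : V → Fin N) (vs : List V) →
  + (2 ℕ.* sum (map (λ v → suc (toℕ (t v))) vs)) ≡
  foldr _+_ 0ℤ (map (label ∘ t) vs) + + (length vs ℕ.* suc N)
double-sum-suc≡sum-label t [] = refl
double-sum-suc≡sum-label {N} t (v ∷ vs) = begin
  + (2 ℕ.* (suc (toℕ (t v)) ℕ.+ S))             ≡⟨ cong +_ (ℕP.*-distribˡ-+ 2 (suc (toℕ (t v))) S) ⟩
  + (2 ℕ.* suc (toℕ (t v))) + + (2 ℕ.* S)       ≡⟨ cong₂ _+_ (sym (label+[1+N]≡2[1+t] (t v))) (double-sum-suc≡sum-label t vs) ⟩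
  (label (t v) + + suc N) + (F + + (length vs ℕ.* suc N))
                                                ≡⟨ interchange (label (t v)) (+ suc N) F _ ⟩
  (label (t v) + F) + + (suc N ℕ.+ length vs ℕ.* suc N) ∎
  where
  open ≡-Reasoning
  S = sum (map (λ v → suc (toℕ (t v))) vs)
  F = foldr _+_ 0ℤ (map (label ∘ t) vs)

regularZeroSum⇒distanceMagic : ∀ {N} {V : Set} (nbrs : V → List V) (r : ℕ) →
  (∀ v → length (nbrs v) ≡ r) → (ℓ : V ⤖ Fin N) →
  (∀ v → foldr _+_ 0ℤ (map (label ∘ Bijection.to ℓ) (nbrs v)) ≡ 0ℤ) →
  DistanceMagicGraph N V nbrs
regularZeroSum⇒distanceMagic {N} nbrs r regular ℓ zeroSum = ℓ , r ℕ.* suc N NDM./ 2 , neighbourSum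
  where
  open Bijection ℓ using (to)
  neighbourSum : ∀ v → sum (map (λ u → suc (toℕ (to u))) (nbrs v)) ≡ r ℕ.* suc N NDM./ 2
  neighbourSum v = begin
    S                  ≡⟨ NDM.m*n/n≡m S 2 ⟨
    S ℕ.* 2 NDM./ 2    ≡⟨ cong (NDM._/ 2) doubled ⟩
    r ℕ.* suc N NDM./ 2 ∎
    where
    open ≡-Reasoning
    S = sum (map (λ u → suc (toℕ (to u))) (nbrs v))
    doubled : S ℕ.* 2 ≡ r ℕ.* suc N
    doubled = ℤP.+-injective (begin
      + (S ℕ.* 2)       ≡⟨ cong +_ (ℕP.*-comm S 2) ⟩
      + (2 ℕ.* S)       ≡⟨ double-sum-suc≡sum-label to (nbrs v) ⟩
      foldr _+_ 0ℤ (map (label ∘ to) (nbrs v)) + + (length (nbrs v) ℕ.* suc N)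
                        ≡⟨ cong₂ (λ z l → z + + (l ℕ.* suc N)) (zeroSum v) (regular v) ⟩
      + (r ℕ.* suc N)   ∎)

signed : Fin 2 → ℤ → ℤ
signed Fin.zero           x = x
signed (Fin.suc Fin.zero) x = - x

signed-0 : ∀ σ → signed σ 0ℤ ≡ 0ℤ
signed-0 Fin.zero           = refl
signed-0 (Fin.suc Fin.zero) = refl

signed-flip : ∀ {σ τ : Fin 2} → + toℕ τ ≡ + toℕ σ + + 1 mod 2 → ∀ x → signed τ x ≡ - signed σ x
signed-flip {Fin.zero} {τ} τ≡1 x with toℕ-≡mod-injective {x = τ} {y = Fin.suc Fin.zero} τ≡1
... | refl = refl
signed-flip {Fin.suc Fin.zero} {τ} τ≡2 x
  with toℕ-≡mod-injective {x = τ} {y = Fin.zero} (≡mod-trans τ≡2 (mk≡mod (+ 1) refl))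
... | refl = sym (ℤP.neg-involutive x)

signed-alternatingSum : ∀ σ A B C D →
  signed σ A + (signed σ B + (- signed σ C + (- signed σ D + 0ℤ))) ≡ signed σ ((B + A) - (C + D))
signed-alternatingSum Fin.zero           = regroup
  where
  regroup : ∀ A B C D → A + (B + (- C + (- D + 0ℤ))) ≡ (B + A) - (C + D)
  regroup = solve-∀
signed-alternatingSum (Fin.suc Fin.zero) = regroup
  where
  regroup : ∀ A B C D → - A + (- B + (- - C + (- - D + 0ℤ))) ≡ - ((B + A) - (C + D))
  regroup = solve-∀

2∤⇒≡1+s+s : ∀ {m} → ¬ (2 ND.∣ m) → ∃ λ s → m ≡ suc (s ℕ.+ s)
2∤⇒≡1+s+s {m} 2∤m with m NDM.% 2 | NDM.m%n<n m 2 | NDM.m≡m%n+[m/n]*n m 2 | ND.m%n≡0⇒n∣m m 2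
... | 0           | _                 | _           | 2∣m = contradiction (2∣m refl) 2∤m
... | 1           | _                 | m≡1+[m/2]*2 | _   =
  m NDM./ 2 , trans m≡1+[m/2]*2 (cong suc (q*2≡q+q (m NDM./ 2)))
  where
  q*2≡q+q : ∀ q → q ℕ.* 2 ≡ q ℕ.+ q
  q*2≡q+q = ℕSolver.solve-∀
... | suc (suc _) | ℕ.s≤s (ℕ.s≤s ()) | _           | _

module _ (s : ℕ) where

  [1+s+s∸1]/2≡s : (suc (s ℕ.+ s) ℕ.∸ 1) NDM./ 2 ≡ s
  [1+s+s∸1]/2≡s = trans (cong (NDM._/ 2) (s+s≡s*2 s)) (NDM.m*n/n≡m s 2)
    where
    s+s≡s*2 : ∀ s → s ℕ.+ s ≡ s ℕ.* 2
    s+s≡s*2 = ℕSolver.solve-∀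

  [1+s+s+1]/2≡1+s : (suc (s ℕ.+ s) ℕ.+ 1) NDM./ 2 ≡ suc s
  [1+s+s+1]/2≡1+s = trans (cong (NDM._/ 2) (1+s+s+1≡[1+s]*2 s)) (NDM.m*n/n≡m (suc s) 2)
    where
    1+s+s+1≡[1+s]*2 : ∀ s → suc (s ℕ.+ s) ℕ.+ 1 ≡ suc s ℕ.* 2
    1+s+s+1≡[1+s]*2 = ℕSolver.solve-∀

SignedSums≡𝒩 : ℕ → (ℕ → ℤ) → (ℕ → ℤ) → Set
SignedSums≡𝒩 m a b = ∀ k → In𝒩 (2 ℕ.* (m ℕ.* m)) k ⇔
  (Σ ℕ λ i → Σ ℕ λ j → i < m × j < m × (k ≡ a i + b j ⊎ k ≡ - (a i + b j)))

module SignedSumTable (s : ℕ) (a b : ℕ → ℤ) (H : SignedSums≡𝒩 (suc (s ℕ.+ s)) a b) where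

  m N : ℕ
  m = suc (s ℕ.+ s)
  N = 2 ℕ.* (m ℕ.* m)

  T : Table m
  T = 𝒯 a s ⊞ 𝒯 b (suc s)

  signedSum : Fin 2 × (Fin m × Fin m) → ℤ
  signedSum (σ , i , j) = signed σ (a (toℕ i) + b (toℕ j))

  signedSum-enumerates : ∀ k → In𝒩 N k ⇔ ∃ λ x → signedSum x ≡ k
  signedSum-enumerates k = mk⇔ to from
    where
    sum≡ : ∀ {i j} (i<m : i < m) (j<m : j < m) → a (toℕ (fromℕ< i<m)) + b (toℕ (fromℕ< j<m)) ≡ a i + b j
    sum≡ i<m j<m = cong₂ (λ i j → a i + b j) (FinP.toℕ-fromℕ< i<m) (FinP.toℕ-fromℕ< j<m)
    to : In𝒩 N k → ∃ λ x → signedSum x ≡ k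
    to k∈𝒩 with Equivalence.to (H k) k∈𝒩
    ... | i , j , i<m , j<m , inj₁ k≡sum  =
      (Fin.zero , fromℕ< i<m , fromℕ< j<m) , trans (sum≡ i<m j<m) (sym k≡sum)
    ... | i , j , i<m , j<m , inj₂ k≡-sum =
      (Fin.suc Fin.zero , fromℕ< i<m , fromℕ< j<m) , trans (cong -_ (sum≡ i<m j<m)) (sym k≡-sum)
    from : (∃ λ x → signedSum x ≡ k) → In𝒩 N k
    from ((σ , i , j) , refl) = Equivalence.from (H _) (toℕ i , toℕ j , FinP.toℕ<n i , FinP.toℕ<n j , sign σ)
      where
      sign : ∀ σ → signed σ (a (toℕ i) + b (toℕ j)) ≡ a (toℕ i) + b (toℕ j) ⊎
                   signed σ (a (toℕ i) + b (toℕ j)) ≡ - (a (toℕ i) + b (toℕ j))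
      sign Fin.zero           = inj₁ refl
      sign (Fin.suc Fin.zero) = inj₂ refl

  signedSum-domain↔Fin : (Fin 2 × (Fin m × Fin m)) ↔ Fin N
  signedSum-domain↔Fin = ↔-sym (↔-trans FinP.*↔× (↔-refl ×-↔ FinP.*↔×))

  module SignedSums = 𝒩-Enumeration signedSum-domain↔Fin signedSum signedSum-enumerates

  T-contains-sums : ∀ i j → Appears T (signedSum (Fin.zero , i , j))
  T-contains-sums i j =
    let (p , q) , diagonal≡i , diagonal≡j = diagonals-surjective s i j
    in  p , q , cong₂ (λ i j → signedSum (Fin.zero , i , j)) diagonal≡i diagonal≡j

  T-omits-negated-sums : ∀ i j → ¬ Appears T (signedSum (Fin.suc Fin.zero , i , j))
  T-omits-negated-sums i j (p , q , T-pq≡-sum) =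
    FinP.0≢1+n (cong proj₁ (SignedSums.g-injective {Fin.zero , diagonal s p q , diagonal (suc s) p q} T-pq≡-sum))

  T-exactly-one-sign : ∀ k → In𝒩 N k → (Appears T k × ¬ Appears T (- k)) ⊎ (¬ Appears T k × Appears T (- k))
  T-exactly-one-sign k k∈𝒩 with Equivalence.to (signedSum-enumerates k) k∈𝒩
  ... | (Fin.zero , i , j) , refl = inj₁ (T-contains-sums i j , T-omits-negated-sums i j)
  ... | (Fin.suc Fin.zero , i , j) , refl =
    inj₂ (T-omits-negated-sums i j , subst (Appears T) (sym (ℤP.neg-involutive _)) (T-contains-sums i j))

  T-vertical≡horizontal : ∀ i j →
    T (shift i (- + 1)) j + T (shift i (+ 1)) j ≡ T i (shift j (+ s)) + T i (shift j (- + s))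
  T-vertical≡horizontal i j = begin
    (A i↑ j + B i↑ j) + (A i↓ j + B i↓ j)   ≡⟨ cong₂ _+_ (cong₂ _+_ A-up B-up) (cong₂ _+_ A-down B-down) ⟩
    (A i j⁺ + B i j⁻) + (A i j⁻ + B i j⁺)   ≡⟨ swap-B (A i j⁺) (B i j⁻) (A i j⁻) (B i j⁺) ⟩
    (A i j⁺ + B i j⁺) + (A i j⁻ + B i j⁻)   ∎
    where
    open ≡-Reasoning
    A B : Table m
    A = 𝒯 a s
    B = 𝒯 b (suc s)
    i↑ i↓ j⁺ j⁻ : Fin m
    i↑ = shift i (- + 1)
    i↓ = shift i (+ 1)
    j⁺ = shift j (+ s)
    j⁻ = shift j (- + s)
    swap-B : ∀ a b c d → (a + b) + (c + d) ≡ (a + d) + (c + b)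
    swap-B = solve-∀
    A-up : A i↑ j ≡ A i j⁺
    A-up = 𝒯-row-shift≡column-shift a s i j (- + 1) (+ s) (≡⇒≡mod (S≡-[S*-1] (+ s)))
      where
      S≡-[S*-1] : ∀ S → S ≡ - (S * - + 1)
      S≡-[S*-1] = solve-∀
    A-down : A i↓ j ≡ A i j⁻
    A-down = 𝒯-row-shift≡column-shift a s i j (+ 1) (- + s) (≡⇒≡mod (-S≡-[S*1] (+ s)))
      where
      -S≡-[S*1] : ∀ S → - S ≡ - (S * + 1)
      -S≡-[S*1] = solve-∀
    B-up : B i↑ j ≡ B i j⁻
    B-up = 𝒯-row-shift≡column-shift b (suc s) i j (- + 1) (- + s) (mk≡mod (- + 1) (-S≡[1+S]-m (+ s)))
      where
      -S≡[1+S]-m : ∀ S → - S ≡ - ((+ 1 + S) * - + 1) + - + 1 * (+ 1 + (S + S))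
      -S≡[1+S]-m = solve-∀
    B-down : B i↓ j ≡ B i j⁺
    B-down = 𝒯-row-shift≡column-shift b (suc s) i j (+ 1) (+ s) (mk≡mod (+ 1) (S≡-[1+S]+m (+ s)))
      where
      S≡-[1+S]+m : ∀ S → S ≡ - ((+ 1 + S) * + 1) + + 1 * (+ 1 + (S + S))
      S≡-[1+S]+m = solve-∀

  distanceMagicTable : DistanceMagicTable m T
  distanceMagicTable = T-exactly-one-sign , subst RowSums (sym ([1+s+s∸1]/2≡s s)) T-vertical≡horizontal
    where
    RowSums : ℕ → Set
    RowSums h = ∀ i j →
      T (shift i (- + 1)) j + T (shift i (+ 1)) j ≡ T i (shift j (+ h)) + T i (shift j (- (+ h)))

  φ : Fin (2 ℕ.* m) → Fin m
  φ y = reduce (+ s * + toℕ y)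

  parity : Fin (2 ℕ.* m) → Fin 2
  parity y = reduce (+ toℕ y)

  φ-shift : ∀ y d c → + s * d ≡ c → φ (shift y d) ≡ shift (φ y) c
  φ-shift y d c sd≡c = toℕ-≡mod-injective (begin
    + toℕ (φ (shift y d))         ≈⟨ toℕ-reduce _ ⟩
    S * + toℕ (shift y d)         ≈⟨ ≡mod-*ˡ S (≡mod-∣ (ND.n∣m*n 2) (toℕ-shift y d)) ⟩
    S * (+ toℕ y + d)             ≡⟨ ℤP.*-distribˡ-+ S (+ toℕ y) d ⟩
    S * + toℕ y + S * d           ≈⟨ ≡mod-+ (toℕ-reduce (S * + toℕ y)) (≡⇒≡mod (sym sd≡c)) ⟨
    + toℕ (φ y) + c               ≈⟨ toℕ-shift (φ y) c ⟨
    + toℕ (shift (φ y) c)         ∎)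
    where
    open ≡mod-Reasoning m
    S = + s

  signed-parity-shift : ∀ y d → d ≡ + 1 mod 2 → ∀ x → signed (parity (shift y d)) x ≡ - signed (parity y) x
  signed-parity-shift y d d≡1 = signed-flip (begin
    + toℕ (parity (shift y d))   ≈⟨ toℕ-reduce _ ⟩
    + toℕ (shift y d)            ≈⟨ ≡mod-∣ (ND.m∣m*n m) (toℕ-shift y d) ⟩
    + toℕ y + d                  ≈⟨ ≡mod-+ (toℕ-reduce (+ toℕ y)) (≡mod-sym d≡1) ⟨
    + toℕ (parity y) + + 1       ∎)
    where open ≡mod-Reasoning 2

  parity-φ-surjective : ∀ (σ : Fin 2) (q : Fin m) → ∃ λ y → parity y ≡ σ × φ y ≡ q
  parity-φ-surjective σ q = y , toℕ-≡mod-injective parity-y≡σ , toℕ-≡mod-injective φ-y≡q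
    where
    S E Q Y : ℤ
    S = + s
    E = + toℕ σ
    Q = + toℕ q
    -- This witness works because m is odd and 2s ≡ −1 (mod m).
    Y = E * (+ 1 + (S + S)) - + 2 * Q
    y : Fin (2 ℕ.* m)
    y = reduce Y
    parity-y≡σ : + toℕ (parity y) ≡ E mod 2
    parity-y≡σ = begin
      + toℕ (parity y)   ≈⟨ toℕ-reduce _ ⟩
      + toℕ y            ≈⟨ ≡mod-∣ (ND.m∣m*n m) (toℕ-reduce Y) ⟩
      Y                  ≈⟨ mk≡mod (E * S - Q) (σm-2q≡σ+[σs-q]2 E S Q) ⟩
      E                  ∎
      where
      open ≡mod-Reasoning 2
      σm-2q≡σ+[σs-q]2 : ∀ E S Q → E * (+ 1 + (S + S)) - + 2 * Q ≡ E + (E * S - Q) * + 2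
      σm-2q≡σ+[σs-q]2 = solve-∀
    φ-y≡q : + toℕ (φ y) ≡ Q mod m
    φ-y≡q = begin
      + toℕ (φ y)        ≈⟨ toℕ-reduce _ ⟩
      S * + toℕ y        ≈⟨ ≡mod-*ˡ S (≡mod-∣ (ND.n∣m*n 2) (toℕ-reduce Y)) ⟩
      S * Y              ≈⟨ mk≡mod (S * E - Q) (s[σm-2q]≡q+[sσ-q]m E S Q) ⟩
      Q                  ∎
      where
      open ≡mod-Reasoning m
      s[σm-2q]≡q+[sσ-q]m : ∀ E S Q → S * (E * (+ 1 + (S + S)) - + 2 * Q) ≡ Q + (S * E - Q) * (+ 1 + (S + S))
      s[σm-2q]≡q+[sσ-q]m = solve-∀

  vertexLabel : CVertex m → ℤ
  vertexLabel (x , y) = signed (parity y) (T x (φ y))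

  vertexLabel-enumerates : ∀ k → In𝒩 N k ⇔ ∃ λ v → vertexLabel v ≡ k
  vertexLabel-enumerates k = mk⇔ to from
    where
    to : In𝒩 N k → ∃ λ v → vertexLabel v ≡ k
    to k∈𝒩 =
      let (σ , i , j) , sum≡k = Equivalence.to (signedSum-enumerates k) k∈𝒩
          (p , q) , diagonal≡i , diagonal≡j = diagonals-surjective s i j
          y , parity≡σ , φ≡q = parity-φ-surjective σ q
      in  (p , y) , (begin
        vertexLabel (p , y)
          ≡⟨ cong₂ (λ σ q → signedSum (σ , diagonal s p q , diagonal (suc s) p q)) parity≡σ φ≡q ⟩
        signedSum (σ , diagonal s p q , diagonal (suc s) p q)
          ≡⟨ cong₂ (λ i j → signedSum (σ , i , j)) diagonal≡i diagonal≡j ⟩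
        signedSum (σ , i , j)
          ≡⟨ sum≡k ⟩
        k ∎)
      where open ≡-Reasoning
    from : (∃ λ v → vertexLabel v ≡ k) → In𝒩 N k
    from ((x , y) , label≡k) = Equivalence.from (signedSum-enumerates k)
      ((parity y , diagonal s x (φ y) , diagonal (suc s) x (φ y)) , label≡k)

  vertex↔Fin : CVertex m ↔ Fin N
  vertex↔Fin = subst (λ n → CVertex m ↔ Fin n) (m*[2*m]≡2*[m*m] m) (↔-sym FinP.*↔×)
    where
    m*[2*m]≡2*[m*m] : ∀ m → m ℕ.* (2 ℕ.* m) ≡ 2 ℕ.* (m ℕ.* m)
    m*[2*m]≡2*[m*m] = ℕSolver.solve-∀

  module VertexLabels = 𝒩-Enumeration vertex↔Fin vertexLabel vertexLabel-enumerates

  vertexLabel-neighbourSum : ∀ v → foldr _+_ 0ℤ (map vertexLabel (CNbrs m v)) ≡ 0ℤ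
  vertexLabel-neighbourSum (x , y) = begin
    signed σ A + (signed σ B + (signed (parity y↑) (T x (φ y↑)) + (signed (parity y↓) (T x (φ y↓)) + 0ℤ)))
      ≡⟨ cong₂ (λ u w → signed σ A + (signed σ B + (u + (w + 0ℤ)))) up down ⟩
    signed σ A + (signed σ B + (- signed σ C + (- signed σ D + 0ℤ)))
      ≡⟨ signed-alternatingSum σ A B C D ⟩
    signed σ ((B + A) - (C + D))
      ≡⟨ cong (λ z → signed σ (z - (C + D))) (T-vertical≡horizontal x q) ⟩
    signed σ ((C + D) - (C + D))
      ≡⟨ cong (signed σ) (ℤP.+-inverseʳ (C + D)) ⟩
    signed σ 0ℤ
      ≡⟨ signed-0 σ ⟩
    0ℤ ∎
    where
    open ≡-Reasoning
    σ = parity y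
    q = φ y
    y↑ y↓ : Fin (2 ℕ.* m)
    y↑ = shift y (+ 1)
    y↓ = shift y (- + 1)
    A B C D : ℤ
    A = T (shift x (+ 1)) q
    B = T (shift x (- + 1)) q
    C = T x (shift q (+ s))
    D = T x (shift q (- + s))
    up : signed (parity y↑) (T x (φ y↑)) ≡ - signed σ C
    up = trans (signed-parity-shift y (+ 1) ≡mod-refl (T x (φ y↑)))
               (cong (λ z → - signed σ (T x z)) (φ-shift y (+ 1) (+ s) (ℤP.*-identityʳ (+ s))))
    down : signed (parity y↓) (T x (φ y↓)) ≡ - signed σ D
    down = trans (signed-parity-shift y (- + 1) (mk≡mod (- + 1) refl) (T x (φ y↓)))
                 (cong (λ z → - signed σ (T x z)) (φ-shift y (- + 1) (- + s) s*-1≡-s))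
      where
      s*-1≡-s : + s * - + 1 ≡ - + s
      s*-1≡-s = trans (ℤP.*-comm (+ s) (- + 1)) (ℤP.-1*i≡-i (+ s))

  graphDistanceMagic : CmCm2DistanceMagic m
  graphDistanceMagic = regularZeroSum⇒distanceMagic (CNbrs m) 4 (λ _ → refl) VertexLabels.index-bijection
    λ v → trans (cong (foldr _+_ 0ℤ) (map-cong VertexLabels.label-index (CNbrs m v))) (vertexLabel-neighbourSum v)

proposition3p2 : (m : ℕ) → 3 ≤ m → ¬ (2 ND.∣ m) →
    (a b : ℕ → ℤ) →
    (∀ i → i < m → ¬ (+ 2 ZD.∣ a i) × (+ 1) - (+ 2) * (+ (m ℕ.* m)) ℤ.≤ a i × a i ℤ.≤ (+ 2) * (+ (m ℕ.* m)) - (+ 1)) →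
    (∀ i → i < m → (+ 2 ZD.∣ b i) × - ((+ 2) * (+ (m ℕ.* m))) ℤ.≤ b i × b i ℤ.≤ (+ 2) * (+ (m ℕ.* m)) - (+ 2)) →
    a 0 ≡ + 1 → b 0 ≡ + 0 →
    (∀ k → In𝒩 (2 ℕ.* (m ℕ.* m)) k ⇔
      (Σ ℕ λ i → Σ ℕ λ j → i < m × j < m × (k ≡ a i + b j ⊎ k ≡ - (a i + b j)))) →
    DistanceMagicTable m (𝒯 {m} a ((m ℕ.∸ 1) NDM./ 2) ⊞ 𝒯 {m} b ((m ℕ.+ 1) NDM./ 2))
    × CmCm2DistanceMagic m
proposition3p2 m _ 2∤m a b _ _ _ _ H with 2∤⇒≡1+s+s 2∤m
... | s , refl =
  subst₂ (λ h h' → DistanceMagicTable m (𝒯 a h ⊞ 𝒯 b h')) (sym ([1+s+s∸1]/2≡s s)) (sym ([1+s+s+1]/2≡1+s s))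
    distanceMagicTable ,
  graphDistanceMagic
  where open SignedSumTable s a b H using (distanceMagicTable; graphDistanceMagic)
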